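{- For every integer $n \geq 0$ and every integer $i \geq 2$, \[ \widetilde{c}_i(n) = \sum_{j=2}^{i} \bar{b}_j(n) \qquad\text{and}\qquad \bar{b}_i(n) = \widetilde{c}_i(n) - \widetilde{c}_{i-1}(n), \] with the convention $\widetilde{c}_1(n) = 0$.
   Context: Tchoukaillon boards. For each $n \geq 0$ define a sequence $b(n) = (b_1(n), b_2(n), \ldots)$ of nonnegative integers recursively: $b(0)$ is the all-zero sequence; given $b(n)$, let $p(n) = \min\{j \geq 1 : b_j(n) = 0\}$ and set $b_i(n+1) = b_i(n)$ if $i > p(n)$, $b_i(n+1) = i$ if $i = p(n)$, and $b_i(n+1) = b_i(n) - 1$ if $i < p(n)$. Reindexed boards: $\bar{b}_i(n) = b_{i-1}(n)$ for $i \geq 2$. Remainder boards: for $i \geq 2$ let $c_i(n) \in \{0, 1, \ldots, i-1\}$ be the remainder of $n$ modulo $i$. Increasing remainder board: $\widetilde{c}_2(n) = c_2(n)$, and for $i \geq 3$, $\widetilde{c}_i(n)$ is the least integer $\geq \widetilde{c}_{i-1}(n)$ that is congruent to $c_i(n)$ modulo $i$. -}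

module Defs where

open import Data.Nat using (ℕ; zero; suc; _+_; _∸_; _≤_; _<_)
open import Data.Nat.DivMod using (_%_)
open import Data.Bool using (Bool; true; false; if_then_else_)
open import Data.Nat using (_≡ᵇ_; _<ᵇ_)

-- A board is a function ℕ → ℕ; position i ≥ 1 holds b_i (position 0 is unused, kept 0).
Board : Set
Board = ℕ → ℕ

-- first j in {k, k+1, ..., k+fuel-1} with b j = 0 (returns k+fuel if none)
firstZeroFrom : Board → ℕ → ℕ → ℕ
firstZeroFrom b k zero = k
firstZeroFrom b k (suc fuel) = if b k ≡ᵇ 0 then k else firstZeroFrom b (suc k) fuel

mutual
  b : ℕ → Board
  b zero i = 0
  b (suc n) i =
    if p n <ᵇ i then b n i
    else if i ≡ᵇ p n then i
    else b n i ∸ 1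

  -- p(n) = min { j ≥ 1 : b_j(n) = 0 }.  Since b_j(n) = 0 for all j > n (an
  -- easy invariant), the minimum lies in {1,…,n+1}, so a search of length n+1
  -- starting at 1 finds it.
  p : ℕ → ℕ
  p n = firstZeroFrom (b n) 1 (suc n)

bbar : ℕ → ℕ → ℕ
bbar n i = b n (i ∸ 1)

c : ℕ → ℕ → ℕ
c n zero = 0
c n (suc i) = n % suc i

-- increasing remainder board, with the convention ctilde n 0 = ctilde n 1 = 0.
-- ctilde n 2 = c_2(n);  for i ≥ 3, ctilde n i = least x ≥ ctilde n (i-1) with
-- x ≡ c_i(n) mod i, namely  prev + ((c_i(n) + i ∸ prev % i) % i).
ctilde : ℕ → ℕ → ℕ
ctilde n zero = 0
ctilde n (suc zero) = 0
ctilde n (suc (suc zero)) = c n 2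
ctilde n (suc (suc (suc k))) =
  let i = suc (suc (suc k)); prev = ctilde n (suc (suc k))
  in prev + ((c n i + i ∸ prev % i) % i)

sum2to : (ℕ → ℕ) → ℕ → ℕ
sum2to f zero = 0
sum2to f (suc zero) = 0
sum2to f (suc (suc k)) = sum2to f (suc k) + f (suc (suc k))

module Submission where

-- Write S(n,k) = b_1(n) + ... + b_k(n) for the k-th prefix sum
-- of the Tchoukaillon board, so that Σ_{j=2}^{i} bbar_j(n) = S(n,i-1).
-- Two invariants of the board dynamics drive everything:
--   (1) 0 ≤ b_j(n) ≤ j, and
--   (2) S(n,k) ≡ n (mod k+1).
-- For (2): in one step from n to n+1, if k < p(n) then each of b_1..b_k
-- loses one token, so S drops by k; if p(n) ≤ k then exactly one token is
-- gained among the first k positions.  Either way S grows by 1 mod k+1.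
-- Given (1) and (2), S(n,i-1) is congruent to n mod i and lies in
-- [S(n,i-2), S(n,i-2) + i), so it is precisely the least number ≥ S(n,i-2)
-- congruent to c_i(n); by induction on i this is ctilde_i(n).  The second
-- identity is then the difference of two consecutive prefix sums.
-- The file proves, in order: modular arithmetic facts, facts about the
-- first-zero search, the one-step behaviour of the board, invariants (1)
-- and (2), the identification ctilde_{k+1}(n) = S(n,k), and the theorem.

open import Defs
open import Data.Product using (_×_; _,_)
open import Data.Sum using (_⊎_; inj₁; inj₂)
open import Data.Bool using (Bool; true; false; if_then_else_; T)
open import Data.Unit using (tt)
open import Data.Empty using (⊥-elim)
open import Relation.Nullary using (¬_; yes; no)
open import Relation.Binary using (tri<; tri≈; tri>)
open import Data.Nat
open import Data.Nat.Properties
open import Data.Nat.DivMod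
open import Relation.Binary.PropositionalEquality
open import Data.Nat.Tactic.RingSolver using (solve-∀)

+-cong-mod : ∀ m a b d .{{_ : NonZero d}} → a % d ≡ b % d → (m + a) % d ≡ (m + b) % d
+-cong-mod m a b d a≡b = begin
  (m + a) % d             ≡⟨ %-distribˡ-+ m a d ⟩
  (m % d + a % d) % d     ≡⟨ cong (λ z → (m % d + z) % d) a≡b ⟩
  (m % d + b % d) % d     ≡⟨ sym (%-distribˡ-+ m b d) ⟩
  (m + b) % d             ∎
  where open ≡-Reasoning

-- The offset from a up to the least number ≥ a congruent to a + x is x
-- itself, provided 0 ≤ x < d.  This is the step performed by ctilde.
offset-mod : ∀ a x d .{{_ : NonZero d}} → x < d → ((a + x) % d + d ∸ a % d) % d ≡ x
offset-mod a x d x<d = begin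
  ((a + x) % d + d ∸ r) % d           ≡⟨ %-congˡ (+-∸-assoc ((a + x) % d) r≤d) ⟩
  ((a + x) % d + (d ∸ r)) % d         ≡⟨ %-distribˡ-+ ((a + x) % d) (d ∸ r) d ⟩
  ((a + x) % d % d + (d ∸ r) % d) % d ≡⟨ cong (λ z → (z + (d ∸ r) % d) % d) (m%n%n≡m%n (a + x) d) ⟩
  ((a + x) % d + (d ∸ r) % d) % d     ≡⟨ sym (%-distribˡ-+ (a + x) (d ∸ r) d) ⟩
  (a + x + (d ∸ r)) % d               ≡⟨ %-congˡ (cong (λ z → z + x + (d ∸ r)) (m≡m%n+[m/n]*n a d)) ⟩
  (r + q * d + x + (d ∸ r)) % d       ≡⟨ %-congˡ (regroup r (q * d) x (d ∸ r)) ⟩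
  (x + (r + (d ∸ r)) + q * d) % d     ≡⟨ %-congˡ (cong (λ z → x + z + q * d) (m+[n∸m]≡n r≤d)) ⟩
  (x + d + q * d) % d                 ≡⟨ [m+kn]%n≡m%n (x + d) q d ⟩
  (x + d) % d                         ≡⟨ [m+n]%n≡m%n x d ⟩
  x % d                               ≡⟨ m<n⇒m%n≡m x<d ⟩
  x                                   ∎
  where
  open ≡-Reasoning
  r = a % d
  q = a / d
  r≤d : r ≤ d
  r≤d = m%n≤n a d
  regroup : ∀ r Q x y → r + Q + x + y ≡ x + (r + y) + Q
  regroup = solve-∀

if-true : ∀ {A : Set} {β : Bool} {x y : A} → T β → (if β then x else y) ≡ x
if-true {β = true} _ = refl

if-false : ∀ {A : Set} {β : Bool} {x y : A} → ¬ T β → (if β then x else y) ≡ y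
if-false {β = true}  ¬t = ⊥-elim (¬t tt)
if-false {β = false} _  = refl

module FirstZero (β : Board) where

  private
    ≡ᵇ0-true : ∀ k → (β k ≡ᵇ 0) ≡ true → β k ≡ 0
    ≡ᵇ0-true k eq = ≡ᵇ⇒≡ (β k) 0 (subst T (sym eq) tt)

    ≡ᵇ0-false : ∀ k → (β k ≡ᵇ 0) ≡ false → β k ≢ 0
    ≡ᵇ0-false k eq z = subst T eq (≡⇒≡ᵇ (β k) 0 z)

  start≤firstZero : ∀ k f → k ≤ firstZeroFrom β k f
  start≤firstZero k zero = ≤-refl
  start≤firstZero k (suc f) with β k ≡ᵇ 0
  ... | true  = ≤-refl
  ... | false = ≤-trans (n≤1+n k) (start≤firstZero (suc k) f)

  firstZero≤zero : ∀ k f m → k ≤ m → β m ≡ 0 → firstZeroFrom β k f ≤ m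
  firstZero≤zero k zero m k≤m _ = k≤m
  firstZero≤zero k (suc f) m k≤m βm≡0 with β k ≡ᵇ 0 in eq
  ... | true = k≤m
  ... | false with m≤n⇒m<n∨m≡n k≤m
  ...   | inj₁ k<m  = firstZero≤zero (suc k) f m k<m βm≡0
  ...   | inj₂ refl = ⊥-elim (≡ᵇ0-false k eq βm≡0)

  nonzero-before-firstZero : ∀ k f j → k ≤ j → j < firstZeroFrom β k f → β j ≢ 0
  nonzero-before-firstZero k zero j k≤j j<k = ⊥-elim (<-irrefl refl (≤-trans j<k k≤j))
  nonzero-before-firstZero k (suc f) j k≤j j<fz with β k ≡ᵇ 0 in eq
  ... | true = ⊥-elim (<-irrefl refl (≤-trans j<fz k≤j))
  ... | false with m≤n⇒m<n∨m≡n k≤j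
  ...   | inj₁ k<j  = nonzero-before-firstZero (suc k) f j k<j j<fz
  ...   | inj₂ refl = ≡ᵇ0-false k eq

  firstZero-exhausted-or-found :
    ∀ k f → firstZeroFrom β k f ≡ k + f ⊎ β (firstZeroFrom β k f) ≡ 0
  firstZero-exhausted-or-found k zero = inj₁ (sym (+-identityʳ k))
  firstZero-exhausted-or-found k (suc f) with β k ≡ᵇ 0 in eq
  ... | true = inj₂ (≡ᵇ0-true k eq)
  ... | false with firstZero-exhausted-or-found (suc k) f
  ...   | inj₁ e   = inj₁ (trans e (sym (+-suc k f)))
  ...   | inj₂ βz  = inj₂ βz

step-above : ∀ n i → p n < i → b (suc n) i ≡ b n i
step-above n i p<i = if-true (<⇒<ᵇ p<i)

step-at : ∀ n → b (suc n) (p n) ≡ p n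
step-at n = trans (if-false (λ t → <-irrefl refl (<ᵇ⇒< (p n) (p n) t)))
                  (if-true (≡⇒≡ᵇ (p n) (p n) refl))

step-below : ∀ n i → i < p n → b (suc n) i ≡ b n i ∸ 1
step-below n i i<p = trans (if-false (λ t → <-asym i<p (<ᵇ⇒< (p n) i t)))
                           (if-false (λ t → <-irrefl (≡ᵇ⇒≡ i (p n) t) i<p))

empty-beyond : ∀ n j → n < j → b n j ≡ 0
empty-beyond zero    j _   = refl
empty-beyond (suc n) j n<j =
  trans (step-above n j (≤-<-trans p≤1+n n<j)) (empty-beyond n j (<-trans (n<1+n n) n<j))
  where
  p≤1+n : p n ≤ suc n
  p≤1+n = FirstZero.firstZero≤zero (b n) 1 (suc n) (suc n) (s≤s z≤n)
            (empty-beyond n (suc n) (n<1+n n))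

p-positive : ∀ n → 1 ≤ p n
p-positive n = FirstZero.start≤firstZero (b n) 1 (suc n)

p-empty : ∀ n → b n (p n) ≡ 0
p-empty n with FirstZero.firstZero-exhausted-or-found (b n) 1 (suc n)
... | inj₁ p≡n+2 = trans (cong (b n) p≡n+2) (empty-beyond n (2 + n) (m≤n⇒m≤1+n (n<1+n n)))
... | inj₂ found = found

nonempty-before-p : ∀ n j → 1 ≤ j → j < p n → 1 ≤ b n j
nonempty-before-p n j 1≤j j<p =
  n≢0⇒n>0 (FirstZero.nonzero-before-firstZero (b n) 1 (suc n) j 1≤j j<p)

b-bounded : ∀ n j → b n j ≤ j
b-bounded zero    j = z≤n
b-bounded (suc n) j with <-cmp j (p n)
... | tri< j<p _ _    = subst (_≤ j) (sym (step-below n j j<p)) (≤-trans (m∸n≤m (b n j) 1) (b-bounded n j))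
... | tri≈ _ refl _   = subst (_≤ p n) (sym (step-at n)) ≤-refl
... | tri> _ _ p<j    = subst (_≤ j) (sym (step-above n j p<j)) (b-bounded n j)

-- Defined through sum2to, so that S(n,0) = 0 and S(n,k+1) = S(n,k) + b_{k+1}(n)
-- hold by computation.
prefix : ℕ → ℕ → ℕ
prefix n k = sum2to (bbar n) (suc k)

prefix-initial : ∀ k → prefix 0 k ≡ 0
prefix-initial zero    = refl
prefix-initial (suc k) = trans (+-identityʳ _) (prefix-initial k)

-- Before p(n) every position loses one token, so S drops by k.
prefix-step-below : ∀ n k → k < p n → prefix (suc n) k + k ≡ prefix n k
prefix-step-below n zero    _   = refl
prefix-step-below n (suc k) k<p = begin
  prefix (suc n) k + b (suc n) (suc k) + suc k ≡⟨ cong (λ z → prefix (suc n) k + z + suc k) (step-below n (suc k) k<p) ⟩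
  prefix (suc n) k + (b n (suc k) ∸ 1) + suc k ≡⟨ regroup (prefix (suc n) k) (b n (suc k) ∸ 1) k ⟩
  (prefix (suc n) k + k) + (b n (suc k) ∸ 1 + 1) ≡⟨ cong₂ _+_ (prefix-step-below n k (<-trans (n<1+n k) k<p))
                                                       (m∸n+n≡m (nonempty-before-p n (suc k) (s≤s z≤n) k<p)) ⟩
  prefix n k + b n (suc k) ∎
  where
  open ≡-Reasoning
  regroup : ∀ a x k → a + x + suc k ≡ (a + k) + (x + 1)
  regroup = solve-∀

prefix-step-above : ∀ n k → p n ≤ k → prefix (suc n) k ≡ suc (prefix n k)
prefix-step-above n zero    p≤0 = ⊥-elim (<-irrefl refl (≤-trans (p-positive n) p≤0))
prefix-step-above n (suc k) p≤k with m≤n⇒m<n∨m≡n p≤k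
... | inj₁ (s≤s p≤k') = cong₂ _+_ (prefix-step-above n k p≤k') (step-above n (suc k) (s≤s p≤k'))
... | inj₂ p≡1+k = begin
  prefix (suc n) k + b (suc n) (suc k) ≡⟨ cong (λ j → prefix (suc n) k + b (suc n) j) (sym p≡1+k) ⟩
  prefix (suc n) k + b (suc n) (p n)   ≡⟨ cong (prefix (suc n) k +_) (trans (step-at n) p≡1+k) ⟩
  prefix (suc n) k + suc k             ≡⟨ +-suc _ k ⟩
  suc (prefix (suc n) k + k)           ≡⟨ cong suc (prefix-step-below n k (subst (k <_) (sym p≡1+k) ≤-refl)) ⟩
  suc (prefix n k)                     ≡⟨ cong suc (sym (+-identityʳ _)) ⟩
  suc (prefix n k + 0)                 ≡⟨ cong (λ z → suc (prefix n k + z)) (sym (p-empty n)) ⟩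
  suc (prefix n k + b n (p n))         ≡⟨ cong (λ j → suc (prefix n k + b n j)) p≡1+k ⟩
  suc (prefix n k + b n (suc k))       ∎
  where open ≡-Reasoning

prefix-mod : ∀ n k → prefix n k % suc k ≡ n % suc k
prefix-mod zero    k = %-congˡ (prefix-initial k)
prefix-mod (suc n) k with k <? p n
... | yes k<p = begin
  prefix (suc n) k % suc k         ≡⟨ sym ([m+n]%n≡m%n (prefix (suc n) k) (suc k)) ⟩
  (prefix (suc n) k + suc k) % suc k ≡⟨ %-congˡ (trans (+-suc _ k) (cong suc (prefix-step-below n k k<p))) ⟩
  suc (prefix n k) % suc k         ≡⟨ +-cong-mod 1 (prefix n k) n (suc k) (prefix-mod n k) ⟩
  suc n % suc k                    ∎
  where open ≡-Reasoning
... | no k≮p = trans (%-congˡ (prefix-step-above n k (≮⇒≥ k≮p)))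
                     (+-cong-mod 1 (prefix n k) n (suc k) (prefix-mod n k))

-- ctilde_{k+1}(n) = S(n,k).  The step uses (2) to identify c_i(n) with
-- S(n,i-1) mod i and (1) to see that S(n,i-1) - S(n,i-2) = b_{i-1}(n) < i.
ctilde≡prefix : ∀ n k → ctilde n (suc k) ≡ prefix n k
ctilde≡prefix n zero          = refl
ctilde≡prefix n (suc zero)    = trans (sym (prefix-mod n 1)) (m<n⇒m%n≡m (s≤s (b-bounded n 1)))
ctilde≡prefix n (suc (suc k)) = begin
  prev + ((n % i + i ∸ prev % i) % i)  ≡⟨ cong (λ z → z + ((n % i + i ∸ z % i) % i)) (ctilde≡prefix n (suc k)) ⟩
  S + ((n % i + i ∸ S % i) % i)        ≡⟨ cong (λ z → S + ((z + i ∸ S % i) % i)) (sym (prefix-mod n (suc (suc k)))) ⟩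
  S + (((S + x) % i + i ∸ S % i) % i)  ≡⟨ cong (S +_) (offset-mod S x i (s≤s (b-bounded n (suc (suc k))))) ⟩
  S + x                                ∎
  where
  open ≡-Reasoning
  i    = suc (suc (suc k))
  prev = ctilde n (suc (suc k))
  S    = prefix n (suc k)
  x    = b n (suc (suc k))

theorem4p2 : (n i : ℕ) → 2 ≤ i →
    (ctilde n i ≡ sum2to (bbar n) i) × (bbar n i ≡ ctilde n i ∸ ctilde n (i ∸ 1))
theorem4p2 n (suc zero)    (s≤s ())
theorem4p2 n (suc (suc k)) _ = ctilde≡prefix n (suc k) , difference
  where
  difference : b n (suc k) ≡ ctilde n (suc (suc k)) ∸ ctilde n (suc k)
  difference = sym (begin
    ctilde n (suc (suc k)) ∸ ctilde n (suc k)  ≡⟨ cong₂ _∸_ (ctilde≡prefix n (suc k)) (ctilde≡prefix n k) ⟩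
    prefix n k + b n (suc k) ∸ prefix n k      ≡⟨ m+n∸m≡n (prefix n k) (b n (suc k)) ⟩
    b n (suc k)                                ∎)
    where open ≡-Reasoning
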